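{- Let $D\in\mathbb{N}$. There is a constant $C_D$ depending only on $D$ such that whenever $M,M'\in\mathcal{M}_D$, $j\in\mathbb{N}$, $m\ge0$, $d_0\ge-1$ and $d_1,\dots,d_m\in\mathbb{N}$ satisfy $$MJA_j=A_{d_0}JA_{d_1}JA_{d_2}\cdots JA_{d_m}M',$$ we have $m\le C_D$.
   Context: For $i\in\mathbb{Z}$ let $A_i=\begin{pmatrix}1&i\\0&1\end{pmatrix}$ and $J=\begin{pmatrix}0&1\\1&0\end{pmatrix}$. For $D\in\mathbb{N}$, $\mathcal{M}_D$ is the set of integer $2\times2$ matrices $\begin{pmatrix}\alpha&\beta\\ \gamma&\delta\end{pmatrix}$ of determinant $\pm D$ satisfying one of: (I) $\gamma=0$, $\beta\ge0$, $\alpha,\delta>0$, $\beta<\delta$; (II) $\delta=0$, $\alpha\ge0$, $\beta,\gamma>0$, $\alpha<\gamma$; (III) $\alpha=0$, $\delta\ge0$, $\beta,\gamma>0$, $\delta<\beta$; (IV) $\beta=0$, $\gamma\ge0$, $\alpha,\delta>0$, $\gamma<\alpha$; (V) $\alpha<0$, $\beta,\gamma,\delta>0$, $|\alpha|<\gamma$; (VI) $\beta<0$, $\alpha,\gamma,\delta>0$, $|\beta|<\delta$. (It is known that for every $M\in\mathcal{M}_D$ and $j\in\mathbb{N}$ such a representation exists, with $m\ge1$ whenever $d_0=-1$.) -}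

module Defs where

open import Data.Nat using (ℕ) renaming (_≤_ to _≤ℕ_)
open import Data.Integer using (ℤ; +_; -_; _+_; _-_; _*_; _<_; _≤_; -1ℤ; 0ℤ; 1ℤ; ∣_∣)
open import Data.Vec using (Vec; []; _∷_)
open import Data.Product using (_×_)
open import Data.Sum using (_⊎_)
open import Relation.Binary.PropositionalEquality using (_≡_)

record Mat : Set where
  constructor mat
  field
    α β γ δ : ℤ
open Mat public

infixl 7 _·_
_·_ : Mat → Mat → Mat
mat a b c d · mat a' b' c' d' =
  mat (a * a' + b * c') (a * b' + b * d') (c * a' + d * c') (c * b' + d * d')

I₂ : Mat
I₂ = mat 1ℤ 0ℤ 0ℤ 1ℤ

A : ℤ → Mat
A i = mat 1ℤ i 0ℤ 1ℤ

J : Mat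
J = mat 0ℤ 1ℤ 1ℤ 0ℤ

det : Mat → ℤ
det (mat a b c d) = a * d - b * c

Cond : Mat → Set
Cond (mat a b c d) =
    (c ≡ 0ℤ × 0ℤ ≤ b × 0ℤ < a × 0ℤ < d × b < d)
  ⊎ (d ≡ 0ℤ × 0ℤ ≤ a × 0ℤ < b × 0ℤ < c × a < c)
  ⊎ (a ≡ 0ℤ × 0ℤ ≤ d × 0ℤ < b × 0ℤ < c × d < b)
  ⊎ (b ≡ 0ℤ × 0ℤ ≤ c × 0ℤ < a × 0ℤ < d × c < a)
  ⊎ (a < 0ℤ × 0ℤ < b × 0ℤ < c × 0ℤ < d × + ∣ a ∣ < c)
  ⊎ (b < 0ℤ × 0ℤ < a × 0ℤ < c × 0ℤ < d × + ∣ b ∣ < d)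

InM : ℕ → Mat → Set
InM D M = (det M ≡ + D ⊎ det M ≡ - (+ D)) × Cond M

JAword : ∀ {m} → Vec ℕ m → Mat
JAword []       = I₂
JAword (d ∷ ds) = J · A (+ d) · JAword ds

{-# OPTIONS --safe #-}

-- Compare bottom-left entries.  On the left it is δ of M, and a case check of (I)–(VI) gives
-- δ ≤ |det M| = D.  On the right, A_{d₀} does not touch the bottom row, so the entry is
-- γ α' + δ γ', with (γ δ) the bottom row of P = J A_{d₁} ⋯ J A_{d_m} and (α', γ') the first
-- column of M'.  Left multiplication by J A_d moves the bottom row of P up and adds d times it
-- to the top row, so for d_i ≥ 1 the entries grow and 0 ≤ m - 1 ≤ γ ≤ δ; the first column of
-- any matrix in 𝓜_D is nonnegative and nonzero.  Hence m - 1 ≤ D.  Neither j nor d₀ matters.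
module Submission where

open import Defs
open import Data.Nat using (ℕ; _≤_; suc; zero; s≤s; z≤n)
open import Data.Integer
  using (ℤ; +_; -1ℤ; 0ℤ; 1ℤ; -_; -[1+_]; ∣_∣; _+_; _-_; _*_; +≤+; +<+; -≤+; nonNegative)
  renaming (_≤_ to _≤ℤ_; _<_ to _<ℤ_)
open import Data.Integer.Properties
open import Data.Integer.Tactic.RingSolver using (solve-∀)
open import Data.Vec using (Vec; []; _∷_)
open import Data.Vec.Relation.Unary.All using (All; []; _∷_)
open import Data.Product using (Σ; _×_; _,_; proj₁; proj₂)
open import Data.Sum using (inj₁; inj₂)
open import Relation.Binary.PropositionalEquality using (_≡_; refl; sym; trans; cong; subst; module ≡-Reasoning)

mat-cong : ∀ {a a' b b' c c' d d'} → a ≡ a' → b ≡ b' → c ≡ c' → d ≡ d' →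
           mat a b c d ≡ mat a' b' c' d'
mat-cong refl refl refl refl = refl

·-identityʳ : ∀ M → M · I₂ ≡ M
·-identityʳ M = mat-cong (unit (α M) (β M)) (unit′ (α M) (β M)) (unit (γ M) (δ M)) (unit′ (γ M) (δ M))
  where
  unit : ∀ x y → x * 1ℤ + y * 0ℤ ≡ x
  unit = solve-∀
  unit′ : ∀ x y → x * 0ℤ + y * 1ℤ ≡ y
  unit′ = solve-∀

A·-rows : ∀ x Q → A x · Q ≡ mat (α Q + x * γ Q) (β Q + x * δ Q) (γ Q) (δ Q)
A·-rows x Q = mat-cong (cong (_+ x * γ Q) (*-identityˡ (α Q))) (cong (_+ x * δ Q) (*-identityˡ (β Q)))
                       (trans (+-identityˡ _) (*-identityˡ (γ Q))) (trans (+-identityˡ _) (*-identityˡ (δ Q)))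

J·A : ∀ d → J · A d ≡ mat 0ℤ 1ℤ 1ℤ d
J·A d = cong (mat 0ℤ 1ℤ 1ℤ) (trans (+-identityʳ (1ℤ * d)) (*-identityˡ d))

J·A·-rows : ∀ d P → J · A d · P ≡ mat (γ P) (δ P) (α P + d * γ P) (β P + d * δ P)
J·A·-rows d P = trans (cong (_· P) (J·A d))
  (mat-cong (trans (+-identityˡ _) (*-identityˡ (γ P))) (trans (+-identityˡ _) (*-identityˡ (δ P)))
            (cong (_+ d * γ P) (*-identityˡ (α P))) (cong (_+ d * δ P) (*-identityˡ (β P))))

-- A j shares its first column with I₂, and the first column of J is the second one of I₂.
γ-·J·A : ∀ M j → γ (M · J · A j) ≡ δ M
γ-·J·A M j = trans (cong γ (·-identityʳ (M · J))) (cong δ (·-identityʳ M))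

i≤j*i : ∀ {i j} → 0ℤ ≤ℤ i → 1ℤ ≤ℤ j → i ≤ℤ j * i
i≤j*i {i} {j} 0≤i 1≤j = begin
  i      ≡⟨ sym (*-identityˡ i) ⟩
  1ℤ * i ≤⟨ *-monoʳ-≤-nonNeg i {{nonNegative 0≤i}} 1≤j ⟩
  j * i  ∎
  where open ≤-Reasoning

i≤i*a+j*c : ∀ {i j a c} → 0ℤ ≤ℤ i → i ≤ℤ j → 0ℤ ≤ℤ c → 0ℤ <ℤ a + c → i ≤ℤ i * a + j * c
i≤i*a+j*c {i} {j} {a} {c} 0≤i i≤j 0≤c 0<a+c = begin
  i               ≡⟨ sym (*-identityʳ i) ⟩
  i * 1ℤ          ≤⟨ *-monoˡ-≤-nonNeg i {{nonNegative 0≤i}} (i<j⇒suc[i]≤j 0<a+c) ⟩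
  i * (a + c)     ≡⟨ *-distribˡ-+ i a c ⟩
  i * a + i * c   ≤⟨ +-monoʳ-≤ (i * a) (*-monoʳ-≤-nonNeg c {{nonNegative 0≤c}} i≤j) ⟩
  i * a + j * c   ∎
  where open ≤-Reasoning

≤-by-difference : ∀ {i j} e → j - i ≡ e → 0ℤ ≤ℤ e → i ≤ℤ j
≤-by-difference e j-i≡e 0≤e = 0≤i-j⇒j≤i (subst (0ℤ ≤ℤ_) (sym j-i≡e) 0≤e)

0≤i*j : ∀ {i j} → 0ℤ ≤ℤ i → 0ℤ ≤ℤ j → 0ℤ ≤ℤ i * j
0≤i*j {i} {j} 0≤i 0≤j = *-monoʳ-≤-nonNeg j {{nonNegative 0≤j}} 0≤i

0≤i-1 : ∀ {i} → 0ℤ <ℤ i → 0ℤ ≤ℤ i - 1ℤ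
0≤i-1 0<i = i≤j⇒0≤j-i (i<j⇒suc[i]≤j 0<i)

0≤-i-1 : ∀ {i} → i <ℤ 0ℤ → 0ℤ ≤ℤ - i - 1ℤ
0≤-i-1 { -[1+ n ]} _ = +≤+ z≤n
0≤-i-1 {+ n} (+<+ ())

i≤∣i∣ : ∀ i → i ≤ℤ + ∣ i ∣
i≤∣i∣ (+ n)    = ≤-refl
i≤∣i∣ -[1+ n ] = -≤+

-i≤∣i∣ : ∀ i → - i ≤ℤ + ∣ i ∣
-i≤∣i∣ i = subst (- i ≤ℤ_) (cong +_ (∣-i∣≡∣i∣ i)) (i≤∣i∣ (- i))

record Growth (k : ℕ) (P : Mat) : Set where
  field
    1≤γ   : 1ℤ ≤ℤ γ P
    k≤γ   : + k ≤ℤ γ P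
    k<α+γ : + suc k ≤ℤ α P + γ P
    α≤β   : α P ≤ℤ β P
    γ≤δ   : γ P ≤ℤ δ P

growth-step : ∀ {k d P} → 1ℤ ≤ℤ d → Growth k P →
              Growth (suc k) (mat (γ P) (δ P) (α P + d * γ P) (β P + d * δ P))
growth-step {k} {d} {P} 1≤d g = record
  { 1≤γ   = ≤-trans (+≤+ (s≤s z≤n)) k<γ′
  ; k≤γ   = k<γ′
  ; k<α+γ = +-mono-≤ 1≤γ k<γ′
  ; α≤β   = γ≤δ
  ; γ≤δ   = +-mono-≤ α≤β (*-monoˡ-≤-nonNeg d {{nonNegative (≤-trans (+≤+ z≤n) 1≤d)}} γ≤δ)
  }
  where
  open Growth g
  k<γ′ : + suc k ≤ℤ α P + d * γ P
  k<γ′ = ≤-trans k<α+γ (+-monoʳ-≤ (α P) (i≤j*i (≤-trans (+≤+ z≤n) 1≤γ) 1≤d))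

JAword-growth : ∀ k (ds : Vec ℕ (suc k)) → All (1 ≤_) ds → Growth k (JAword ds)
JAword-growth zero (d ∷ []) (1≤d ∷ []) =
  subst (Growth 0) (sym (trans (·-identityʳ (J · A (+ d))) (J·A (+ d)))) record
    { 1≤γ = ≤-refl ; k≤γ = +≤+ z≤n ; k<α+γ = ≤-refl ; α≤β = +≤+ z≤n ; γ≤δ = +≤+ 1≤d }
JAword-growth (suc k) (d ∷ ds) (1≤d ∷ 1≤ds) =
  subst (Growth (suc k)) (sym (J·A·-rows (+ d) (JAword ds)))
    (growth-step (+≤+ 1≤d) (JAword-growth k ds 1≤ds))

first-column : ∀ M → Cond M → 0ℤ ≤ℤ γ M × 0ℤ <ℤ α M + γ M
first-column (mat a b c d) (inj₁ (refl , _ , 0<a , _ , _)) =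
  ≤-refl , subst (0ℤ <ℤ_) (sym (+-identityʳ a)) 0<a
first-column (mat a b c d) (inj₂ (inj₁ (_ , 0≤a , _ , 0<c , _))) =
  <⇒≤ 0<c , +-mono-≤-< 0≤a 0<c
first-column (mat a b c d) (inj₂ (inj₂ (inj₁ (refl , _ , _ , 0<c , _)))) =
  <⇒≤ 0<c , subst (0ℤ <ℤ_) (sym (+-identityˡ c)) 0<c
first-column (mat a b c d) (inj₂ (inj₂ (inj₂ (inj₁ (_ , 0≤c , 0<a , _ , _))))) =
  0≤c , +-mono-<-≤ 0<a 0≤c
first-column (mat -[1+ n ] b c d) (inj₂ (inj₂ (inj₂ (inj₂ (inj₁ (_ , _ , 0<c , _ , ∣a∣<c)))))) =
  <⇒≤ 0<c , subst (_<ℤ -[1+ n ] + c) (+-inverseʳ -[1+ n ]) (+-monoʳ-< -[1+ n ] ∣a∣<c)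
first-column (mat (+ n) b c d) (inj₂ (inj₂ (inj₂ (inj₂ (inj₁ (+<+ () , _))))))
first-column (mat a b c d) (inj₂ (inj₂ (inj₂ (inj₂ (inj₂ (_ , 0<a , 0<c , _ , _)))))) =
  <⇒≤ 0<c , +-mono-<-≤ 0<a (<⇒≤ 0<c)

δ≤∣det∣ : ∀ M → Cond M → δ M ≤ℤ + ∣ det M ∣
δ≤∣det∣ (mat a b c d) (inj₁ (refl , _ , 0<a , 0<d , _)) =
  ≤-trans (≤-by-difference _ (I a b d) (0≤i*j (0≤i-1 0<a) (<⇒≤ 0<d))) (i≤∣i∣ (det (mat a b c d)))
  where
  I : ∀ a b d → (a * d - b * 0ℤ) - d ≡ (a - 1ℤ) * d
  I = solve-∀
δ≤∣det∣ (mat a b c d) (inj₂ (inj₁ (refl , _))) = +≤+ z≤n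
δ≤∣det∣ (mat a b c d) (inj₂ (inj₂ (inj₁ (refl , _ , 0<b , 0<c , d<b)))) =
  ≤-trans (≤-by-difference _ (III b c d)
             (+-mono-≤ (i≤j⇒0≤j-i (<⇒≤ d<b)) (0≤i*j (<⇒≤ 0<b) (0≤i-1 0<c))))
          (-i≤∣i∣ (det (mat a b c d)))
  where
  III : ∀ b c d → - (0ℤ * d - b * c) - d ≡ (b - d) + b * (c - 1ℤ)
  III = solve-∀
δ≤∣det∣ (mat a b c d) (inj₂ (inj₂ (inj₂ (inj₁ (refl , _ , 0<a , 0<d , _))))) =
  ≤-trans (≤-by-difference _ (IV a c d) (0≤i*j (0≤i-1 0<a) (<⇒≤ 0<d))) (i≤∣i∣ (det (mat a b c d)))
  where
  IV : ∀ a c d → (a * d - 0ℤ * c) - d ≡ (a - 1ℤ) * d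
  IV = solve-∀
δ≤∣det∣ (mat a b c d) (inj₂ (inj₂ (inj₂ (inj₂ (inj₁ (a<0 , 0<b , 0<c , 0<d , _)))))) =
  ≤-trans (≤-by-difference _ (V a b c d)
             (+-mono-≤ (0≤i*j (<⇒≤ 0<b) (<⇒≤ 0<c)) (0≤i*j (0≤-i-1 a<0) (<⇒≤ 0<d))))
          (-i≤∣i∣ (det (mat a b c d)))
  where
  V : ∀ a b c d → - (a * d - b * c) - d ≡ b * c + (- a - 1ℤ) * d
  V = solve-∀
δ≤∣det∣ (mat a b c d) (inj₂ (inj₂ (inj₂ (inj₂ (inj₂ (b<0 , 0<a , 0<c , 0<d , _)))))) =
  ≤-trans (≤-by-difference _ (VI a b c d)
             (+-mono-≤ (+-mono-≤ (0≤i*j (0≤i-1 0<a) (<⇒≤ 0<d)) (0≤i*j (0≤-i-1 b<0) (<⇒≤ 0<c))) (<⇒≤ 0<c)))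
          (i≤∣i∣ (det (mat a b c d)))
  where
  VI : ∀ a b c d → (a * d - b * c) - d ≡ (a - 1ℤ) * d + (- b - 1ℤ) * c + c
  VI = solve-∀

∣det∣≡ : ∀ {D M} → InM D M → ∣ det M ∣ ≡ D
∣det∣≡     (inj₁ det≡D  , _) = cong ∣_∣ det≡D
∣det∣≡ {D} (inj₂ det≡-D , _) = trans (cong ∣_∣ det≡-D) (∣-i∣≡∣i∣ (+ D))

δ-via-bottom-left : ∀ {M M' P j d₀} → M · J · A j ≡ A d₀ · P · M' →
                    δ M ≡ γ P * α M' + δ P * γ M'
δ-via-bottom-left {M} {M'} {P} {j} {d₀} eq = begin
  δ M                       ≡⟨ sym (γ-·J·A M j) ⟩
  γ (M · J · A j)           ≡⟨ cong γ eq ⟩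
  γ (A d₀ · P · M')         ≡⟨ cong (λ Q → γ (Q · M')) (A·-rows d₀ P) ⟩
  γ P * α M' + δ P * γ M'   ∎
  where open ≡-Reasoning

length≤suc-D : ∀ {D M M' j d₀ m} {ds : Vec ℕ m} → InM D M → InM D M' → All (1 ≤_) ds →
               M · J · A j ≡ A d₀ · JAword ds · M' → m ≤ suc D
length≤suc-D {m = zero} _ _ _ _ = z≤n
length≤suc-D {D} {M} {M'} {j} {d₀} {suc k} {ds} M∈ M'∈ 1≤ds eq = s≤s (drop‿+≤+ (begin
  + k                       ≤⟨ k≤γ ⟩
  γ P                       ≤⟨ i≤i*a+j*c (≤-trans (+≤+ z≤n) 1≤γ) γ≤δ 0≤γ′ 0<α′+γ′ ⟩
  γ P * α M' + δ P * γ M'   ≡⟨ sym (δ-via-bottom-left {M} {M'} {P} {j} {d₀} eq) ⟩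
  δ M                       ≤⟨ δ≤∣det∣ M (proj₂ M∈) ⟩
  + ∣ det M ∣               ≡⟨ cong +_ (∣det∣≡ M∈) ⟩
  + D                       ∎))
  where
  open ≤-Reasoning
  P : Mat
  P = JAword ds
  open Growth (JAword-growth k ds 1≤ds)
  0≤γ′ : 0ℤ ≤ℤ γ M'
  0≤γ′ = proj₁ (first-column M' (proj₂ M'∈))
  0<α′+γ′ : 0ℤ <ℤ α M' + γ M'
  0<α′+γ′ = proj₂ (first-column M' (proj₂ M'∈))

lemma2p2 : (D : ℕ) → 1 ≤ D →
    Σ ℕ λ C →
      (M M' : Mat) → InM D M → InM D M' →
      (j : ℕ) → 1 ≤ j →
      (m : ℕ) → (d₀ : ℤ) → -1ℤ ≤ℤ d₀ →
      (ds : Vec ℕ m) → All (1 ≤_) ds →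
      M · J · A (+ j) ≡ A d₀ · JAword ds · M' →
      m ≤ C
lemma2p2 D _ = suc D , λ M M' M∈ M'∈ j _ m d₀ _ ds 1≤ds eq →
  length≤suc-D {j = + j} {d₀} M∈ M'∈ 1≤ds eq
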